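{- Let $X$ be a nominal set and $n\in\mathbb{N}$. Two pretraces $w,v\in\overline{\mathbb{A}}^n\times X$ are $\alpha$-equivalent if and only if $X\vdash_n w=v$ is derivable in the theory $T^{\mathsf{tr}}$.
   Context: Names and nominal sets: $\mathbb{A}$ is a countably infinite set of names, $G$ the group of finite permutations of $\mathbb{A}$, $(a\,b)$ transpositions. A nominal set is a set with a $G$-action in which every element $x$ has a least finite support $\mathsf{supp}(x)$ ($\pi\cdot x=x$ whenever $\pi$ fixes $\mathsf{supp}(x)$ pointwise); $a\# x$ means $a\notin\mathsf{supp}(x)$. For a nominal set $Z$, $[\mathbb{A}]Z$ is the quotient of $\mathbb{A}\times Z$ by $(a,z)\sim(b,z')$ iff $(c\,a)\cdot z=(c\,b)\cdot z'$ for some $c$ fresh for $a,b,z,z'$; classes $\langle a\rangle z$. Bar strings and pretraces: $\overline{\mathbb{A}}=\mathbb{A}\cup\{|a\mid a\in\mathbb{A}\}$ (the letter $|a$ is a bound occurrence of $a$), with $\pi\cdot a=\pi(a)$, $\pi\cdot|a=|\pi(a)$, acting letterwise on $\overline{\mathbb{A}}^*$ and componentwise on $\overline{\mathbb{A}}^*\times X$. A pretrace of length $n$ is an element $wx$ of $\overline{\mathbb{A}}^n\times X$ (a bar string $w$ followed by $x\in X$). $\alpha$-equivalence $\equiv_\alpha$ on pretraces is the equivalence relation generated by $w\,|a\,v\equiv_\alpha w\,|b\,u$ whenever $w\in\overline{\mathbb{A}}^*$, $v,u\in\overline{\mathbb{A}}^*\times X$ and $\langle a\rangle v=\langle b\rangle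 u$ in $[\mathbb{A}](\overline{\mathbb{A}}^*\times X)$. The theory $T^{\mathsf{tr}}$: the signature has no pure operations, one free operation $\mathsf{pre}$ of arity 1 and depth 1, and one bound operation $\mathsf{abs}$ of arity 1 and depth 1; there are no axioms. Its terms over $X$ are $x$, $a.\mathsf{pre}(t)$ and $\nu a.\mathsf{abs}(t)$; a term has uniform depth $n$ iff it has exactly $n$ operations. A pretrace $\sigma_1\cdots\sigma_n x$ is identified with the term obtained by reading $a$ as $a.\mathsf{pre}(-)$ and $|a$ as $\nu a.\mathsf{abs}(-)$, e.g. $a\,|b\,x=a.\mathsf{pre}(\nu b.\mathsf{abs}(x))$. Terms form a nominal set under $\pi\cdot a.\mathsf{pre}(t)=\pi(a).\mathsf{pre}(\pi\cdot t)$, $\pi\cdot\nu a.\mathsf{abs}(t)=\nu\pi(a).\mathsf{abs}(\pi\cdot t)$ and the action of $X$ on variables. Derivable judgements $X\vdash_m t=u$ in $T^{\mathsf{tr}}$ are the least set closed under: (refl) $X\vdash_0x=x$ for $x\in X$; (symm); (trans); (cong) from $X\vdash_m t=u$ infer $X\vdash_{m+1}a.\mathsf{pre}(t)=a.\mathsf{pre}(u)$ and $X\vdash_{m+1}\nu a.\mathsf{abs}(t)=\nu a.\mathsf{abs}(u)$; (perm) for names $a\ne b$ with $a\# u$ (support of the raw term $u$), from $X\vdash_m t=(a\,b)\cdot u$ infer $X\vdash_{m+1}\nu a.\mathsf{abs}(t)=\nu b.\mathsf{abs}(u)$. -}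

module Defs where

open import Data.Nat using (ℕ)
open import Data.Nat.Properties using (_≟_)
open import Data.List using (List; []; _∷_; _++_; map; length)
open import Data.List.Membership.Propositional using (_∈_; _∉_)
open import Data.Product using (Σ; _×_; _,_; proj₁; proj₂)
open import Relation.Nullary using (¬_; yes; no)
open import Relation.Binary.PropositionalEquality
  using (_≡_; _≢_; refl; sym; trans; cong)

Name : Set
Name = ℕ

record Perm : Set where
  field
    fun    : Name → Name
    inv    : Name → Name
    inv-l  : ∀ a → inv (fun a) ≡ a
    inv-r  : ∀ a → fun (inv a) ≡ a
    dom    : List Name
    finite : ∀ a → a ∉ dom → fun a ≡ a
open Perm public

idPerm : Perm
idPerm = record { fun = λ a → a ; inv = λ a → a ; inv-l = λ _ → refl
                ; inv-r = λ _ → refl ; dom = [] ; finite = λ _ _ → refl }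

_∘ₚ_ : Perm → Perm → Perm
π ∘ₚ σ = record
  { fun = λ a → fun π (fun σ a)
  ; inv = λ a → inv σ (inv π a)
  ; inv-l = λ a → trans (cong (inv σ) (inv-l π (fun σ a))) (inv-l σ a)
  ; inv-r = λ a → trans (cong (fun π) (inv-r σ (inv π a))) (inv-r π a)
  ; dom = dom π ++ dom σ
  ; finite = λ a a∉ → trans (cong (fun π) (finite σ a (λ m → a∉ (++ʳ m))))
                            (finite π a (λ m → a∉ (++ˡ m)))
  }
  where
  open import Data.List.Membership.Propositional.Properties
    using (∈-++⁺ˡ; ∈-++⁺ʳ)
  ++ˡ : ∀ {a} → a ∈ dom π → a ∈ dom π ++ dom σ
  ++ˡ = ∈-++⁺ˡ
  ++ʳ : ∀ {a} → a ∈ dom σ → a ∈ dom π ++ dom σ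
  ++ʳ = ∈-++⁺ʳ (dom π)

swapFn : Name → Name → Name → Name
swapFn a b c with c ≟ a
... | yes _ = b
... | no _ with c ≟ b
...   | yes _ = a
...   | no _ = c

private
  swapFn-a : ∀ a b → swapFn a b a ≡ b
  swapFn-a a b with a ≟ a
  ... | yes _ = refl
  ... | no ¬p with () ← ¬p refl

  swapFn-b : ∀ a b → swapFn a b b ≡ a
  swapFn-b a b with b ≟ a
  ... | yes p = p
  ... | no _ with b ≟ b
  ...   | yes _ = refl
  ...   | no ¬p with () ← ¬p refl

  swapFn-other : ∀ a b c → c ≢ a → c ≢ b → swapFn a b c ≡ c
  swapFn-other a b c c≢a c≢b with c ≟ a
  ... | yes p with () ← c≢a p
  ... | no _ with c ≟ b
  ...   | yes p with () ← c≢b p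
  ...   | no _ = refl

  swapFn-invol : ∀ a b c → swapFn a b (swapFn a b c) ≡ c
  swapFn-invol a b c with c ≟ a
  ... | yes refl = swapFn-b c b
  ... | no c≢a with c ≟ b
  ...   | yes refl = swapFn-a a c
  ...   | no c≢b = swapFn-other a b c c≢a c≢b

  swapFn-fin : ∀ a b c → c ∉ (a ∷ b ∷ []) → swapFn a b c ≡ c
  swapFn-fin a b c c∉ =
    swapFn-other a b c (λ p → c∉ (here p)) (λ p → c∉ (there (here p)))
    where open import Data.List.Relation.Unary.Any using (here; there)

swap : Name → Name → Perm
swap a b = record
  { fun = swapFn a b ; inv = swapFn a b
  ; inv-l = swapFn-invol a b ; inv-r = swapFn-invol a b
  ; dom = a ∷ b ∷ [] ; finite = swapFn-fin a b }

record Nominal : Set₁ where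
  field
    Carrier  : Set
    act      : Perm → Carrier → Carrier
    act-ext  : ∀ π σ x → (∀ a → fun π a ≡ fun σ a) → act π x ≡ act σ x
    act-id   : ∀ x → act idPerm x ≡ x
    act-comp : ∀ π σ x → act (π ∘ₚ σ) x ≡ act π (act σ x)
    supp          : Carrier → List Name
    supp-supports : ∀ π x → (∀ a → a ∈ supp x → fun π a ≡ a) → act π x ≡ x
    supp-least    : ∀ x (S : List Name) →
                    (∀ π → (∀ a → a ∈ S → fun π a ≡ a) → act π x ≡ x) →
                    ∀ a → a ∈ supp x → a ∈ S
open Nominal public

data BarLetter : Set where
  free  : Name → BarLetter
  bound : Name → BarLetter

actBar : Perm → BarLetter → BarLetter
actBar π (free a)  = free (fun π a)
actBar π (bound a) = bound (fun π a)

nameOf : BarLetter → Name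
nameOf (free a)  = a
nameOf (bound a) = a

-- elements of 𝔸̄* × X ; a pretrace of length n is one whose bar string
-- has length n
Pretrace : Nominal → Set
Pretrace X = List BarLetter × Carrier X

actPre : (X : Nominal) → Perm → Pretrace X → Pretrace X
actPre X π (w , x) = map (actBar π) w , act X π x

suppPre : (X : Nominal) → Pretrace X → List Name
suppPre X (w , x) = map nameOf w ++ supp X x

-- ⟨a⟩v = ⟨b⟩u in [𝔸](𝔸̄* × X)
AbsEq : (X : Nominal) → Name → Pretrace X → Name → Pretrace X → Set
AbsEq X a v b u =
  Σ Name λ c → c ≢ a × c ≢ b × c ∉ suppPre X v × c ∉ suppPre X u ×
               actPre X (swap c a) v ≡ actPre X (swap c b) u

data AlphaEq (X : Nominal) : Pretrace X → Pretrace X → Set where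
  α-refl  : ∀ p → AlphaEq X p p
  α-sym   : ∀ {p q} → AlphaEq X p q → AlphaEq X q p
  α-trans : ∀ {p q r} → AlphaEq X p q → AlphaEq X q r → AlphaEq X p r
  α-step  : ∀ (w : List BarLetter) a b (v u : Pretrace X) → AbsEq X a v b u →
            AlphaEq X (w ++ bound a ∷ proj₁ v , proj₂ v)
                      (w ++ bound b ∷ proj₁ u , proj₂ u)

data Term (X : Nominal) : Set where
  var : Carrier X → Term X
  pre : Name → Term X → Term X
  abs : Name → Term X → Term X

actTerm : (X : Nominal) → Perm → Term X → Term X
actTerm X π (var x)   = var (act X π x)
actTerm X π (pre a t) = pre (fun π a) (actTerm X π t)
actTerm X π (abs a t) = abs (fun π a) (actTerm X π t)

suppTerm : (X : Nominal) → Term X → List Name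
suppTerm X (var x)   = supp X x
suppTerm X (pre a t) = a ∷ suppTerm X t
suppTerm X (abs a t) = a ∷ suppTerm X t

toTerm : (X : Nominal) → Pretrace X → Term X
toTerm X ([] , x)          = var x
toTerm X (free a ∷ w , x)  = pre a (toTerm X (w , x))
toTerm X (bound a ∷ w , x) = abs a (toTerm X (w , x))

data Derivable (X : Nominal) : ℕ → Term X → Term X → Set where
  d-refl  : ∀ x → Derivable X 0 (var x) (var x)
  d-sym   : ∀ {m t u} → Derivable X m t u → Derivable X m u t
  d-trans : ∀ {m t u s} → Derivable X m t u → Derivable X m u s →
            Derivable X m t s
  d-cong-pre : ∀ {m t u} a → Derivable X m t u →
               Derivable X (ℕ.suc m) (pre a t) (pre a u)
  d-cong-abs : ∀ {m t u} a → Derivable X m t u →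
               Derivable X (ℕ.suc m) (abs a t) (abs a u)
  d-perm  : ∀ {m t u} a b → a ≢ b → a ∉ suppTerm X u →
            Derivable X m t (actTerm X (swap a b) u) →
            Derivable X (ℕ.suc m) (abs a t) (abs b u)

-- Derivations in T^tr are syntax directed: each rule other than symmetry and
-- transitivity consumes one letter, so derivations and α-equivalences can be
-- translated into each other by induction.  An α-step ⟨a⟩v = ⟨b⟩u, witnessed
-- by a fresh c with (c a)·v = (c b)·u, becomes two perm steps meeting at
-- νc.abs((c a)·v).  Conversely a perm step νa.abs(t) = νb.abs(u) with a # u is
-- congruent to νa.abs((a b)·u), and ⟨a⟩((a b)·u) = ⟨b⟩u is an α-step.  The
-- index n is the common length because α-equivalence preserves length.

module Submission where

open import Defs
open import Data.Nat using (ℕ; suc; _≤_)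
open import Data.Nat.Properties using (_≟_; ≤-trans; m≤m+n; m≤n+m; <-irrefl)
open import Data.Nat.ListAction using (sum)
open import Data.List using (List; []; _∷_; _++_; map; length)
open import Data.List.Properties using (length-map; map-cong-local; map-∘)
open import Data.List.Membership.Propositional using (_∈_; _∉_)
open import Data.List.Membership.Propositional.Properties using (∈-++⁺ˡ; ∈-++⁺ʳ; ∈-map⁺)
open import Data.List.Relation.Unary.Any using (here; there)
open import Data.List.Relation.Unary.All using (tabulate)
open import Data.Product using (proj₁; proj₂; _,_)
open import Relation.Nullary using (yes; no)
open import Relation.Binary.PropositionalEquality
open import Function.Bundles using (_⇔_; mk⇔)

swap-right : ∀ a b → swapFn a b b ≡ a
swap-right a b with b ≟ a
... | yes b≡a = b≡a
... | no _ with b ≟ b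
...   | yes _ = refl
...   | no b≢b with () ← b≢b refl

swap-other : ∀ a b c → c ≢ a → c ≢ b → swapFn a b c ≡ c
swap-other a b c c≢a c≢b with c ≟ a
... | yes c≡a with () ← c≢a c≡a
... | no _ with c ≟ b
...   | yes c≡b with () ← c≢b c≡b
...   | no _ = refl

swap-∘-swap : ∀ a b c d → d ≢ a → d ≢ c →
              fun (swap c a ∘ₚ swap a b) d ≡ fun (swap c b) d
swap-∘-swap a b c d d≢a d≢c with d ≟ b
... | yes refl = begin
  swapFn c a (swapFn a d d) ≡⟨ cong (swapFn c a) (swap-right a d) ⟩
  swapFn c a a              ≡⟨ swap-right c a ⟩
  c                         ≡⟨ swap-right c d ⟨
  swapFn c d d              ∎
  where open ≡-Reasoning
... | no d≢b = begin
  swapFn c a (swapFn a b d) ≡⟨ cong (swapFn c a) (swap-other a b d d≢a d≢b) ⟩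
  swapFn c a d              ≡⟨ swap-other c a d d≢c d≢a ⟩
  d                         ≡⟨ swap-other c b d d≢c d≢b ⟨
  swapFn c b d              ∎
  where open ≡-Reasoning

∈⇒≤sum : ∀ {n} (ns : List ℕ) → n ∈ ns → n ≤ sum ns
∈⇒≤sum (n ∷ ns) (here refl) = m≤m+n n (sum ns)
∈⇒≤sum (m ∷ ns) (there n∈ns) = ≤-trans (∈⇒≤sum ns n∈ns) (m≤n+m (sum ns) m)

fresh : List Name → Name
fresh ns = suc (sum ns)

fresh-∉ : ∀ ns → fresh ns ∉ ns
fresh-∉ ns fresh∈ns = <-irrefl refl (∈⇒≤sum ns fresh∈ns)

infix 30 _⁻¹ₚ

_⁻¹ₚ : Perm → Perm
σ ⁻¹ₚ = record
  { fun = inv σ ; inv = fun σ ; inv-l = inv-r σ ; inv-r = inv-l σ ; dom = dom σ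
  ; finite = λ a a∉ → trans (cong (inv σ) (sym (finite σ a a∉))) (inv-l σ a) }

actBar-∘ : ∀ π σ l → actBar (π ∘ₚ σ) l ≡ actBar π (actBar σ l)
actBar-∘ π σ (free a)  = refl
actBar-∘ π σ (bound a) = refl

actBar-cong : ∀ π σ l → fun π (nameOf l) ≡ fun σ (nameOf l) → actBar π l ≡ actBar σ l
actBar-cong π σ (free a)  = cong free
actBar-cong π σ (bound a) = cong bound

map-actBar-cong : ∀ π σ (w : List BarLetter) →
                  (∀ d → d ∈ map nameOf w → fun π d ≡ fun σ d) →
                  map (actBar π) w ≡ map (actBar σ) w
map-actBar-cong π σ w agree =
  map-cong-local (tabulate λ l∈w → actBar-cong π σ _ (agree _ (∈-map⁺ nameOf l∈w)))

module _ (X : Nominal) where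

  -- π = σ ∘ (σ⁻¹ ∘ π), and σ⁻¹ ∘ π fixes supp x pointwise.
  act-cong-supp : ∀ π σ x → (∀ d → d ∈ supp X x → fun π d ≡ fun σ d) →
                  act X π x ≡ act X σ x
  act-cong-supp π σ x agree = begin
    act X π x                           ≡⟨ act-ext X π (σ ∘ₚ (σ ⁻¹ₚ ∘ₚ π)) x
                                             (λ d → sym (inv-r σ (fun π d))) ⟩
    act X (σ ∘ₚ (σ ⁻¹ₚ ∘ₚ π)) x         ≡⟨ act-comp X σ (σ ⁻¹ₚ ∘ₚ π) x ⟩
    act X σ (act X (σ ⁻¹ₚ ∘ₚ π) x)      ≡⟨ cong (act X σ) (supp-supports X (σ ⁻¹ₚ ∘ₚ π) x
                                             λ d d∈ → trans (cong (inv σ) (agree d d∈)) (inv-l σ d)) ⟩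
    act X σ x                           ∎
    where open ≡-Reasoning

  actPre-∘ : ∀ π σ p → actPre X (π ∘ₚ σ) p ≡ actPre X π (actPre X σ p)
  actPre-∘ π σ (w , x) =
    cong₂ _,_ (trans (map-cong-local (tabulate λ {l} _ → actBar-∘ π σ l)) (map-∘ w))
              (act-comp X π σ x)

  actPre-cong-supp : ∀ π σ p → (∀ d → d ∈ suppPre X p → fun π d ≡ fun σ d) →
                     actPre X π p ≡ actPre X σ p
  actPre-cong-supp π σ (w , x) agree =
    cong₂ _,_ (map-actBar-cong π σ w λ d d∈ → agree d (∈-++⁺ˡ d∈))
              (act-cong-supp π σ x λ d d∈ → agree d (∈-++⁺ʳ (map nameOf w) d∈))

  actPre-length : ∀ π p → length (proj₁ (actPre X π p)) ≡ length (proj₁ p)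
  actPre-length π (w , x) = length-map (actBar π) w

  fromTerm : Term X → Pretrace X
  fromTerm (var x)   = [] , x
  fromTerm (pre a t) = free a ∷ proj₁ (fromTerm t) , proj₂ (fromTerm t)
  fromTerm (abs a t) = bound a ∷ proj₁ (fromTerm t) , proj₂ (fromTerm t)

  fromTerm-toTerm : ∀ p → fromTerm (toTerm X p) ≡ p
  fromTerm-toTerm ([] , x) = refl
  fromTerm-toTerm (free a ∷ w , x)  rewrite fromTerm-toTerm (w , x) = refl
  fromTerm-toTerm (bound a ∷ w , x) rewrite fromTerm-toTerm (w , x) = refl

  suppTerm-fromTerm : ∀ t → suppTerm X t ≡ suppPre X (fromTerm t)
  suppTerm-fromTerm (var x)   = refl
  suppTerm-fromTerm (pre a t) = cong (a ∷_) (suppTerm-fromTerm t)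
  suppTerm-fromTerm (abs a t) = cong (a ∷_) (suppTerm-fromTerm t)

  suppTerm-toTerm : ∀ p → suppTerm X (toTerm X p) ≡ suppPre X p
  suppTerm-toTerm p =
    trans (suppTerm-fromTerm (toTerm X p)) (cong (suppPre X) (fromTerm-toTerm p))

  fromTerm-actTerm : ∀ π t → fromTerm (actTerm X π t) ≡ actPre X π (fromTerm t)
  fromTerm-actTerm π (var x) = refl
  fromTerm-actTerm π (pre a t) rewrite fromTerm-actTerm π t = refl
  fromTerm-actTerm π (abs a t) rewrite fromTerm-actTerm π t = refl

  actTerm-toTerm : ∀ π p → actTerm X π (toTerm X p) ≡ toTerm X (actPre X π p)
  actTerm-toTerm π ([] , x)          = refl
  actTerm-toTerm π (free a ∷ w , x)  = cong (pre (fun π a)) (actTerm-toTerm π (w , x))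
  actTerm-toTerm π (bound a ∷ w , x) = cong (abs (fun π a)) (actTerm-toTerm π (w , x))

  AlphaEq-cons : ∀ l {p q} → AlphaEq X p q →
                 AlphaEq X (l ∷ proj₁ p , proj₂ p) (l ∷ proj₁ q , proj₂ q)
  AlphaEq-cons l (α-refl p)           = α-refl _
  AlphaEq-cons l (α-sym e)            = α-sym (AlphaEq-cons l e)
  AlphaEq-cons l (α-trans e e′)       = α-trans (AlphaEq-cons l e) (AlphaEq-cons l e′)
  AlphaEq-cons l (α-step w a b v u e) = α-step (l ∷ w) a b v u e

  -- For fresh c, (c a) ∘ (a b) and (c b) agree on supp u, as a, c # u.
  AbsEq-swap : ∀ a b u → a ∉ suppPre X u → AbsEq X a (actPre X (swap a b) u) b u
  AbsEq-swap a b u a#u =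
    c , (λ c≡a → c#L (here c≡a)) , (λ c≡b → c#L (there (here c≡b)))
      , (λ c∈ → c#L (there (there (∈-++⁺ˡ c∈))))
      , c#u
      , (begin
          actPre X (swap c a) (actPre X (swap a b) u) ≡⟨ actPre-∘ (swap c a) (swap a b) u ⟨
          actPre X (swap c a ∘ₚ swap a b) u           ≡⟨ actPre-cong-supp _ _ u agree ⟩
          actPre X (swap c b) u                       ∎)
    where
    open ≡-Reasoning
    L = a ∷ b ∷ suppPre X (actPre X (swap a b) u) ++ suppPre X u
    c = fresh L
    c#L = fresh-∉ L
    c#u : c ∉ suppPre X u
    c#u c∈ = c#L (there (there (∈-++⁺ʳ (suppPre X (actPre X (swap a b) u)) c∈)))
    agree : ∀ d → d ∈ suppPre X u → fun (swap c a ∘ₚ swap a b) d ≡ fun (swap c b) d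
    agree d d∈ = swap-∘-swap a b c d (λ { refl → a#u d∈ }) (λ { refl → c#u d∈ })

  Derivable⇒AlphaEq : ∀ {m t u} → Derivable X m t u → AlphaEq X (fromTerm t) (fromTerm u)
  Derivable⇒AlphaEq (d-refl x)        = α-refl _
  Derivable⇒AlphaEq (d-sym d)         = α-sym (Derivable⇒AlphaEq d)
  Derivable⇒AlphaEq (d-trans d d′)    = α-trans (Derivable⇒AlphaEq d) (Derivable⇒AlphaEq d′)
  Derivable⇒AlphaEq (d-cong-pre a d)  = AlphaEq-cons (free a) (Derivable⇒AlphaEq d)
  Derivable⇒AlphaEq (d-cong-abs a d)  = AlphaEq-cons (bound a) (Derivable⇒AlphaEq d)
  Derivable⇒AlphaEq (d-perm {u = u} a b _ a#u d) =
    α-trans (AlphaEq-cons (bound a) t≡α[ab]u)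
            (α-step [] a b (actPre X (swap a b) (fromTerm u)) (fromTerm u)
              (AbsEq-swap a b (fromTerm u) (subst (a ∉_) (suppTerm-fromTerm u) a#u)))
    where
    t≡α[ab]u = subst (AlphaEq X _) (fromTerm-actTerm (swap a b) u) (Derivable⇒AlphaEq d)

  reindex : ∀ {m m′ t u} → m ≡ m′ → Derivable X m t u → Derivable X m′ t u
  reindex = subst (λ m → Derivable X m _ _)

  Derivable-refl : ∀ p → Derivable X (length (proj₁ p)) (toTerm X p) (toTerm X p)
  Derivable-refl ([] , x)          = d-refl x
  Derivable-refl (free a ∷ w , x)  = d-cong-pre a (Derivable-refl (w , x))
  Derivable-refl (bound a ∷ w , x) = d-cong-abs a (Derivable-refl (w , x))

  AbsEq-length : ∀ {a v b u} → AbsEq X a v b u → length (proj₁ v) ≡ length (proj₁ u)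
  AbsEq-length {a} {v} {b} {u} (c , _ , _ , _ , _ , eq) = begin
    length (proj₁ v)                        ≡⟨ actPre-length (swap c a) v ⟨
    length (proj₁ (actPre X (swap c a) v))  ≡⟨ cong (λ p → length (proj₁ p)) eq ⟩
    length (proj₁ (actPre X (swap c b) u))  ≡⟨ actPre-length (swap c b) u ⟩
    length (proj₁ u)                        ∎
    where open ≡-Reasoning

  AlphaEq-length : ∀ {p q} → AlphaEq X p q → length (proj₁ p) ≡ length (proj₁ q)
  AlphaEq-length (α-refl p)     = refl
  AlphaEq-length (α-sym e)      = sym (AlphaEq-length e)
  AlphaEq-length (α-trans e e′) = trans (AlphaEq-length e) (AlphaEq-length e′)
  AlphaEq-length (α-step w a b v u e) = prefix w
    where
    prefix : ∀ w′ → length (w′ ++ bound a ∷ proj₁ v) ≡ length (w′ ++ bound b ∷ proj₁ u)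
    prefix []       = cong suc (AbsEq-length e)
    prefix (_ ∷ w′) = cong suc (prefix w′)

  Derivable-abs-swap : ∀ c a p → c ≢ a → c ∉ suppPre X p →
    Derivable X (suc (length (proj₁ p)))
      (abs c (toTerm X (actPre X (swap c a) p))) (abs a (toTerm X p))
  Derivable-abs-swap c a p c≢a c#p =
    d-perm c a c≢a (subst (c ∉_) (sym (suppTerm-toTerm p)) c#p)
      (subst (Derivable X _ _) (sym (actTerm-toTerm (swap c a) p))
        (reindex (actPre-length (swap c a) p) (Derivable-refl (actPre X (swap c a) p))))

  AbsEq⇒Derivable : ∀ {a v b u} → AbsEq X a v b u →
    Derivable X (suc (length (proj₁ v))) (abs a (toTerm X v)) (abs b (toTerm X u))
  AbsEq⇒Derivable {a} {v} {b} {u} e@(c , c≢a , c≢b , c#v , c#u , eq) =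
    d-trans (d-sym (Derivable-abs-swap c a v c≢a c#v)) via-c
    where
    via-c : Derivable X (suc (length (proj₁ v)))
              (abs c (toTerm X (actPre X (swap c a) v))) (abs b (toTerm X u))
    via-c rewrite eq = reindex (cong suc (sym (AbsEq-length e))) (Derivable-abs-swap c b u c≢b c#u)

  AlphaEq⇒Derivable : ∀ {p q} → AlphaEq X p q →
                      Derivable X (length (proj₁ p)) (toTerm X p) (toTerm X q)
  AlphaEq⇒Derivable (α-refl p)     = Derivable-refl p
  AlphaEq⇒Derivable (α-sym e)      = reindex (AlphaEq-length e) (d-sym (AlphaEq⇒Derivable e))
  AlphaEq⇒Derivable (α-trans e e′) =
    d-trans (AlphaEq⇒Derivable e) (reindex (sym (AlphaEq-length e)) (AlphaEq⇒Derivable e′))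
  AlphaEq⇒Derivable (α-step w a b v u e) = under w
    where
    under : ∀ w′ → Derivable X (length (w′ ++ bound a ∷ proj₁ v))
                     (toTerm X (w′ ++ bound a ∷ proj₁ v , proj₂ v))
                     (toTerm X (w′ ++ bound b ∷ proj₁ u , proj₂ u))
    under []             = AbsEq⇒Derivable e
    under (free l ∷ w′)  = d-cong-pre l (under w′)
    under (bound l ∷ w′) = d-cong-abs l (under w′)

lemma2 : (X : Nominal) (n : ℕ) (w v : Pretrace X) →
         length (proj₁ w) ≡ n → length (proj₁ v) ≡ n →
         AlphaEq X w v ⇔ Derivable X n (toTerm X w) (toTerm X v)
lemma2 X n w v |w|≡n _ = mk⇔
  (λ w≡αv → reindex X |w|≡n (AlphaEq⇒Derivable X w≡αv))
  (λ ⊢w=v → subst₂ (AlphaEq X) (fromTerm-toTerm X w) (fromTerm-toTerm X v)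
                   (Derivable⇒AlphaEq X ⊢w=v))
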